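{- Let $G$ be a hypergraph and $k$ an integer. If $G$ has a separation of order $<k$ that distinguishes two tangles, then $G$ has a separation $(A,\overline A)$ such that $(A,\overline A)$ distinguishes two tangles, $\lambda(A)<k$, $|V(A)|\le|V(\overline A)|$, both $A$ and $\overline A$ are well-linked, and $A$ is internally connected.
   Context: A hypergraph $G$ consists of finite sets $V(G)$, $E(G)$ and for each hyperedge $e$ a set $V(e)\subseteq V(G)$ (distinct hyperedges may share vertex sets), every vertex lying in some $V(e)$. For $A\subseteq E(G)$: $V(A)=\bigcup_{e\in A}V(e)$, $\overline A=E(G)\setminus A$, $\mathrm{bd}(A)=V(A)\cap V(\overline A)$, $\lambda(A)=|\mathrm{bd}(A)|$. A separation is a pair $(A,\overline A)$, of order $\lambda(A)$. $A$ is well-linked if for every pair $(B_1,B_2)$ of disjoint, possibly empty, sets with union $A$, $\lambda(B_1)\ge\lambda(A)$ or $\lambda(B_2)\ge\lambda(A)$. A non-empty $A$ is internally connected if there is no partition of $A$ into two non-empty sets $B_1,B_2$ with $\mathrm{bd}(B_i)\subseteq\mathrm{bd}(A)$ for both $i$. A tangle of order $k'$ is a family $\mathscr{T}$ of subsets of $E(G)$ with: (1) $\lambda(X)<k'$ for all $X\in\mathscr{T}$; (2) for every $X$ with $\lambda(X)<k'$, $X\in\mathscr{T}$ or $\overline X\in\mathscr{T}$; (3) no $X,Y,Z\in\mathscr{T}$ with $X\cup Y\cup Z=E(G)$; (4) $E(G)\setminus\{e\}\notin\mathscr{T}$ for all $e\in E(G)$. A tangle is a tangle of some order. A separation $(A,\overline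 A)$ distinguishes tangles $\mathscr{T}_1,\mathscr{T}_2$ if $A\in\mathscr{T}_1$ and $\overline A\in\mathscr{T}_2$. -}

module Defs where

open import Data.Nat using (ℕ; suc; _<_; _≤_; _≥_)
open import Data.Bool using (Bool; true; false; _∧_; _∨_)
open import Data.Fin using (Fin; zero; suc)
open import Data.Fin.Subset using (Subset; _∈_; _⊆_; _∩_; _∪_; ∁; ∣_∣; Empty; Nonempty; ⊤; ⁅_⁆)
open import Data.Vec using (lookup; tabulate)
open import Data.Product using (Σ; ∃; _×_)
open import Data.Sum using (_⊎_)
open import Relation.Binary.PropositionalEquality using (_≡_)
open import Relation.Nullary using (¬_)

-- A hypergraph with vertex set Fin nV and hyperedge set Fin nE.
-- inc e is the vertex set V(e) ⊆ V(G); distinct hyperedges may share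
-- vertex sets; every vertex lies in some V(e).
record Hypergraph : Set where
  field
    nV    : ℕ
    nE    : ℕ
    inc   : Fin nE → Subset nV
    cover : (v : Fin nV) → ∃ λ e → v ∈ inc e

open Hypergraph public

anyFin : ∀ {m} → (Fin m → Bool) → Bool
anyFin {ℕ.zero} f = false
anyFin {suc m} f = f zero ∨ anyFin (λ i → f (suc i))

ESet : Hypergraph → Set
ESet G = Subset (nE G)

-- V(A) = union of V(e) over e ∈ A
Vof : (G : Hypergraph) → ESet G → Subset (nV G)
Vof G A = tabulate λ v → anyFin λ e → lookup A e ∧ lookup (inc G e) v

co : (G : Hypergraph) → ESet G → ESet G
co G A = ∁ A

bd : (G : Hypergraph) → ESet G → Subset (nV G)
bd G A = Vof G A ∩ Vof G (co G A)

lam : (G : Hypergraph) → ESet G → ℕ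
lam G A = ∣ bd G A ∣

WellLinked : (G : Hypergraph) → ESet G → Set
WellLinked G A =
  (B₁ B₂ : ESet G) → Empty (B₁ ∩ B₂) → B₁ ∪ B₂ ≡ A →
  (lam G B₁ ≥ lam G A) ⊎ (lam G B₂ ≥ lam G A)

InternallyConnected : (G : Hypergraph) → ESet G → Set
InternallyConnected G A =
  Nonempty A ×
  ¬ (Σ (ESet G) λ B₁ → Σ (ESet G) λ B₂ →
       Nonempty B₁ × Nonempty B₂ × Empty (B₁ ∩ B₂) × (B₁ ∪ B₂ ≡ A) ×
       (bd G B₁ ⊆ bd G A) × (bd G B₂ ⊆ bd G A))

Family : Hypergraph → Set₁
Family G = ESet G → Set

record IsTangle (G : Hypergraph) (k' : ℕ) (T : Family G) : Set where
  field
    t1 : (X : ESet G) → T X → lam G X < k'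
    t2 : (X : ESet G) → lam G X < k' → T X ⊎ T (co G X)
    t3 : (X Y Z : ESet G) → T X → T Y → T Z → ¬ (X ∪ Y ∪ Z ≡ ⊤)
    t4 : (e : Fin (nE G)) → ¬ T (∁ ⁅ e ⁆)

IsTangleSomeOrder : (G : Hypergraph) → Family G → Set
IsTangleSomeOrder G T = ∃ λ k' → IsTangle G k' T

Distinguishes : (G : Hypergraph) → ESet G → Family G → Family G → Set
Distinguishes G A T₁ T₂ = T₁ A × T₂ (co G A)

DistinguishesTwoTangles : (G : Hypergraph) → ESet G → Set₁
DistinguishesTwoTangles G A =
  Σ (Family G) λ T₁ → Σ (Family G) λ T₂ →
    IsTangleSomeOrder G T₁ × IsTangleSomeOrder G T₂ × Distinguishes G A T₁ T₂

-- Take a separation (A, Ā) of order < k distinguishing two tangles that is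
-- minimal in the lexicographic order on (λ(A), |V(A)|, |A|).  If |V(A)| > |V(Ā)|
-- then Ā is smaller.  If A (or Ā) is not well-linked, or A is not internally
-- connected, then A (or Ā) splits into two parts of order at most λ(A), and the
-- tangle axioms force one of the parts to distinguish the same two tangles; that
-- part is smaller.
module Submission where

open import Defs
open import Data.Nat using (_≤_)
open import Data.Integer using (ℤ; +_; _<_)
open import Data.Fin.Subset using (∣_∣)
open import Data.Product using (Σ; _×_)

import Level
open import Data.Nat as ℕ using (ℕ; _≤?_; _<?_)
open import Data.Nat.Properties using (<⇒≤; ≤-reflexive; ≤-<-trans; ≰⇒>; ≮⇒≥; m≤n⇒m<n∨m≡n)
open import Data.Nat.Induction using (<-wellFounded)
import Data.Integer as ℤ
import Data.Integer.Properties as ℤ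
open import Data.Bool using (Bool; true; false; _∧_; _∨_)
open import Data.Bool.Properties using (∨-zeroʳ) renaming (_≟_ to _≟ᵇ_)
open import Data.Fin using (Fin; zero; suc)
open import Data.Fin.Subset using (Subset; _∈_; _⊆_; _⊂_; _∩_; _∪_; ∁; Empty; Nonempty; ⊤)
open import Data.Fin.Subset.Properties
open import Data.Vec using (lookup)
open import Data.Vec.Properties using (≡-dec; []=⇒lookup; lookup⇒[]=; lookup∘tabulate)
open import Data.Product using (∃; ∃₂; _,_; map₁; map₂)
open import Data.Product.Relation.Binary.Lex.Strict using (×-Lex; ×-wellFounded)
open import Data.Sum using (_⊎_; inj₁; inj₂; [_,_]′)
import Data.Sum as Sum
open import Data.Empty using (⊥-elim)
open import Relation.Nullary using (¬_; yes; no)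
open import Relation.Nullary.Decidable using (_×-dec_; ¬?)
open import Relation.Binary using (Rel)
open import Relation.Binary.Construct.On as On using ()
open import Relation.Binary.PropositionalEquality using (_≡_; refl; sym; trans; cong; subst)
open import Induction.WellFounded using (WellFounded; Acc; acc)
open import Function using (_on_; _∘′_)
import Algebra.Lattice.Properties.BooleanAlgebra as BooleanAlgebra

wellFounded-descent : ∀ {a r p q} {A : Set a} {_<_ : Rel A r} → WellFounded _<_ →
  {P : A → Set p} {Q : A → Set q} →
  (∀ x → P x → Q x ⊎ ∃ λ y → y < x × P y) →
  ∀ x → P x → ∃ λ x → P x × Q x
wellFounded-descent {_<_ = _<_} wf {P} {Q} step x px = go x px (wf x)
  where
  go : ∀ x → P x → Acc _<_ x → ∃ λ x → P x × Q x
  go x px (acc smaller) with step x px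
  ... | inj₁ qx = x , px , qx
  ... | inj₂ (y , y<x , py) = go y py (smaller y<x)

∁-involutive : ∀ {n} (p : Subset n) → ∁ (∁ p) ≡ p
∁-involutive {n} = BooleanAlgebra.¬-involutive (∪-∩-booleanAlgebra n)

module _ {n : ℕ} {B₁ B₂ X : Subset n} (B₁∪B₂≡X : B₁ ∪ B₂ ≡ X) where

  ∪≡⇒⊆ˡ : B₁ ⊆ X
  ∪≡⇒⊆ˡ = subst (B₁ ⊆_) B₁∪B₂≡X (p⊆p∪q B₂)

  ∪≡⇒⊆ʳ : B₂ ⊆ X
  ∪≡⇒⊆ʳ = subst (B₂ ⊆_) B₁∪B₂≡X (q⊆p∪q B₁ B₂)

  ∪≡⇒cover : ∀ x → x ∈ B₁ ⊎ x ∈ B₂ ⊎ x ∈ ∁ X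
  ∪≡⇒cover x with x ∈? X
  ... | yes x∈X = Sum.map₂ inj₁ (x∈p∪q⁻ B₁ B₂ (subst (x ∈_) (sym B₁∪B₂≡X) x∈X))
  ... | no  x∉X = inj₂ (inj₂ (x∉p⇒x∈∁p x∉X))

anyFin⁻ : ∀ {m} (f : Fin m → Bool) → anyFin f ≡ true → ∃ λ i → f i ≡ true
anyFin⁻ {ℕ.suc m} f any≡true with f zero in f0≡
... | true  = zero , f0≡
... | false with anyFin⁻ (λ i → f (suc i)) any≡true
...   | i , fi≡true = suc i , fi≡true

anyFin⁺ : ∀ {m} (f : Fin m → Bool) i → f i ≡ true → anyFin f ≡ true
anyFin⁺ f zero    f0≡true = cong (_∨ anyFin (λ i → f (suc i))) f0≡true
anyFin⁺ f (suc i) fi≡true =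
  trans (cong (f zero ∨_) (anyFin⁺ (λ j → f (suc j)) i fi≡true)) (∨-zeroʳ (f zero))

∧≡true⁻ : ∀ {a b} → a ∧ b ≡ true → a ≡ true × b ≡ true
∧≡true⁻ {true} b≡true = refl , b≡true

∧≡true⁺ : ∀ {a b} → a ≡ true → b ≡ true → a ∧ b ≡ true
∧≡true⁺ refl refl = refl

module _ (G : Hypergraph) where

  ∈-Vof⁻ : ∀ {A v} → v ∈ Vof G A → ∃ λ e → e ∈ A × v ∈ inc G e
  ∈-Vof⁻ {A} {v} v∈VA with anyFin⁻ _ (trans (sym (lookup∘tabulate _ v)) ([]=⇒lookup v∈VA))
  ... | e , e∈A∧v∈e with ∧≡true⁻ {lookup A e} e∈A∧v∈e
  ...   | e∈A , v∈e = e , lookup⇒[]= e A e∈A , lookup⇒[]= v (inc G e) v∈e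

  ∈-Vof⁺ : ∀ {A v e} → e ∈ A → v ∈ inc G e → v ∈ Vof G A
  ∈-Vof⁺ {A} {v} {e} e∈A v∈e = lookup⇒[]= v (Vof G A)
    (trans (lookup∘tabulate _ v)
      (anyFin⁺ _ e (∧≡true⁺ ([]=⇒lookup e∈A) ([]=⇒lookup v∈e))))

  Vof-mono : ∀ {B A} → B ⊆ A → Vof G B ⊆ Vof G A
  Vof-mono B⊆A v∈VB with ∈-Vof⁻ v∈VB
  ... | e , e∈B , v∈e = ∈-Vof⁺ (B⊆A e∈B) v∈e

  lam-co : ∀ A → lam G (co G A) ≡ lam G A
  lam-co A = cong ∣_∣ (trans (cong (λ X → Vof G (∁ A) ∩ Vof G X) (∁-involutive A)) (∩-comm _ _))

  module _ {k : ℕ} {T : Family G} (τ : IsTangle G k T) where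
    open IsTangle τ

    tangle-cover-⊥ : ∀ {X Y Z} → T X → T Y → T Z → ¬ (∀ e → e ∈ X ⊎ e ∈ Y ⊎ e ∈ Z)
    tangle-cover-⊥ {X} {Y} {Z} TX TY TZ covers =
      t3 X Y Z TX TY TZ (⊆-antisym (λ _ → ∈⊤) (λ {e} _ → join (covers e)))
      where
      join : ∀ {e} → e ∈ X ⊎ e ∈ Y ⊎ e ∈ Z → e ∈ X ∪ Y ∪ Z
      join = x∈p∪q⁺ ∘′ Sum.map₂ x∈p∪q⁺

    tangle-⊆-closed : ∀ {X B} → T X → B ⊆ X → lam G B ℕ.< k → T B
    tangle-⊆-closed {X} {B} TX B⊆X B<k with t2 B B<k
    ... | inj₁ TB  = TB
    ... | inj₂ TB̄ = ⊥-elim (tangle-cover-⊥ TX TB̄ TB̄ covers)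
      where
      covers : ∀ e → e ∈ X ⊎ e ∈ ∁ B ⊎ e ∈ ∁ B
      covers e with e ∈? X
      ... | yes e∈X = inj₁ e∈X
      ... | no  e∉X = inj₂ (inj₁ (x∉p⇒x∈∁p (λ e∈B → e∉X (B⊆X e∈B))))

    tangle-co-nonempty : ∀ {A} → T (co G A) → Nonempty A
    tangle-co-nonempty {A} TĀ with nonempty? A
    ... | yes ne = ne
    ... | no  empty =
      ⊥-elim (tangle-cover-⊥ TĀ TĀ TĀ λ e → inj₁ (x∉p⇒x∈∁p λ e∈A → empty (e , e∈A)))

  distinguishes-co : ∀ {A} → DistinguishesTwoTangles G A → DistinguishesTwoTangles G (co G A)
  distinguishes-co {A} (T₁ , T₂ , τ₁ , τ₂ , T₁A , T₂Ā) =
    T₂ , T₁ , τ₂ , τ₁ , T₂Ā , subst T₁ (sym (∁-involutive A)) T₁A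

  distinguished-nonempty : ∀ {A} → DistinguishesTwoTangles G A → Nonempty A
  distinguished-nonempty (_ , _ , _ , (_ , τ₂) , _ , T₂Ā) = tangle-co-nonempty τ₂ T₂Ā

  distinguishing-part : ∀ {X B₁ B₂} → DistinguishesTwoTangles G X → B₁ ∪ B₂ ≡ X →
    lam G B₁ ≤ lam G X → lam G B₂ ≤ lam G X →
    DistinguishesTwoTangles G B₁ ⊎ DistinguishesTwoTangles G B₂
  distinguishing-part {X} {B₁} {B₂} (T₁ , T₂ , (k₁ , τ₁) , (k₂ , τ₂) , T₁X , T₂X̄)
                      B₁∪B₂≡X B₁≤X B₂≤X =
    choose (IsTangle.t2 τ₂ B₁ (≤-<-trans B₁≤X X<k₂)) (IsTangle.t2 τ₂ B₂ (≤-<-trans B₂≤X X<k₂))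
    where
    X<k₂ : lam G X ℕ.< k₂
    X<k₂ = subst (ℕ._< k₂) (lam-co X) (IsTangle.t1 τ₂ (co G X) T₂X̄)

    T₁-part : ∀ {B} → B ⊆ X → lam G B ≤ lam G X → T₁ B
    T₁-part B⊆X B≤X = tangle-⊆-closed τ₁ T₁X B⊆X (≤-<-trans B≤X (IsTangle.t1 τ₁ X T₁X))

    distinguishes : ∀ {B} → B ⊆ X → lam G B ≤ lam G X → T₂ (co G B) → DistinguishesTwoTangles G B
    distinguishes B⊆X B≤X T₂B̄ = T₁ , T₂ , (k₁ , τ₁) , (k₂ , τ₂) , T₁-part B⊆X B≤X , T₂B̄

    choose : T₂ B₁ ⊎ T₂ (co G B₁) → T₂ B₂ ⊎ T₂ (co G B₂) →
      DistinguishesTwoTangles G B₁ ⊎ DistinguishesTwoTangles G B₂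
    choose (inj₂ T₂B̄₁) _            = inj₁ (distinguishes (∪≡⇒⊆ˡ B₁∪B₂≡X) B₁≤X T₂B̄₁)
    choose (inj₁ _)    (inj₂ T₂B̄₂) = inj₂ (distinguishes (∪≡⇒⊆ʳ B₁∪B₂≡X) B₂≤X T₂B̄₂)
    choose (inj₁ T₂B₁) (inj₁ T₂B₂) =
      ⊥-elim (tangle-cover-⊥ τ₂ T₂B₁ T₂B₂ T₂X̄ (∪≡⇒cover B₁∪B₂≡X))

  size : ESet G → ℕ × ℕ × ℕ
  size A = lam G A , ∣ Vof G A ∣ , ∣ A ∣

  _≺_ : Rel (ESet G) Level.zero
  _≺_ = ×-Lex _≡_ ℕ._<_ (×-Lex _≡_ ℕ._<_ ℕ._<_) on size

  ≺-wellFounded : WellFounded _≺_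
  ≺-wellFounded =
    On.wellFounded size (×-wellFounded <-wellFounded (×-wellFounded <-wellFounded <-wellFounded))

  ≺⇒lam≤ : ∀ {B A} → B ≺ A → lam G B ≤ lam G A
  ≺⇒lam≤ (inj₁ B<A)       = <⇒≤ B<A
  ≺⇒lam≤ (inj₂ (B≡A , _)) = ≤-reflexive B≡A

  ⊂⇒≺ : ∀ {B A} → lam G B ≤ lam G A → B ⊂ A → B ≺ A
  ⊂⇒≺ {B} {A} B≤A B⊂A with m≤n⇒m<n∨m≡n B≤A | m≤n⇒m<n∨m≡n (p⊆q⇒∣p∣≤∣q∣ (Vof-mono (p⊂q⇒p⊆q B⊂A)))
  ... | inj₁ λB<λA | _            = inj₁ λB<λA
  ... | inj₂ λB≡λA | inj₁ VB<VA = inj₂ (λB≡λA , inj₁ VB<VA)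
  ... | inj₂ λB≡λA | inj₂ VB≡VA = inj₂ (λB≡λA , inj₂ (VB≡VA , p⊂q⇒∣p∣<∣q∣ B⊂A))

  LowerOrderSplit : ESet G → Set
  LowerOrderSplit X = ∃₂ λ B₁ B₂ → B₁ ∪ B₂ ≡ X × lam G B₁ ℕ.< lam G X × lam G B₂ ℕ.< lam G X

  wellLinked⊎lowerOrderSplit : ∀ X → WellLinked G X ⊎ LowerOrderSplit X
  wellLinked⊎lowerOrderSplit X with anySubset? (λ B₁ → anySubset? λ B₂ →
      ≡-dec _≟ᵇ_ (B₁ ∪ B₂) X ×-dec (lam G B₁ <? lam G X) ×-dec (lam G B₂ <? lam G X))
  ... | yes split = inj₂ split
  ... | no ¬split = inj₁ wellLinked
    where
    wellLinked : WellLinked G X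
    wellLinked B₁ B₂ _ B₁∪B₂≡X with lam G X ≤? lam G B₁
    ... | yes X≤B₁ = inj₁ X≤B₁
    ... | no  X≰B₁ = inj₂ (≮⇒≥ λ B₂<X → ¬split (B₁ , B₂ , B₁∪B₂≡X , ≰⇒> X≰B₁ , B₂<X))

  -- InternallyConnected G A is definitionally Nonempty A × ¬ Disconnection A.
  Disconnection : ESet G → Set
  Disconnection A = Σ (ESet G) λ B₁ → Σ (ESet G) λ B₂ →
    Nonempty B₁ × Nonempty B₂ × Empty (B₁ ∩ B₂) × (B₁ ∪ B₂ ≡ A) ×
    (bd G B₁ ⊆ bd G A) × (bd G B₂ ⊆ bd G A)

  internallyConnected⊎disconnection : ∀ A → Nonempty A → InternallyConnected G A ⊎ Disconnection A
  internallyConnected⊎disconnection A ne with anySubset? (λ B₁ → anySubset? λ B₂ →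
      nonempty? B₁ ×-dec nonempty? B₂ ×-dec ¬? (nonempty? (B₁ ∩ B₂)) ×-dec
      ≡-dec _≟ᵇ_ (B₁ ∪ B₂) A ×-dec (bd G B₁ ⊆? bd G A) ×-dec (bd G B₂ ⊆? bd G A))
  ... | yes disconnection = inj₂ disconnection
  ... | no  connected     = inj₁ (ne , connected)

  lowerOrderSplit⇒distinguishing : ∀ {X} → DistinguishesTwoTangles G X → LowerOrderSplit X →
    ∃ λ B → lam G B ℕ.< lam G X × DistinguishesTwoTangles G B
  lowerOrderSplit⇒distinguishing d (B₁ , B₂ , B₁∪B₂≡X , B₁<X , B₂<X) =
    [ (λ d₁ → B₁ , B₁<X , d₁) , (λ d₂ → B₂ , B₂<X , d₂) ]′
      (distinguishing-part d B₁∪B₂≡X (<⇒≤ B₁<X) (<⇒≤ B₂<X))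

  disconnection⇒distinguishing : ∀ {A} → DistinguishesTwoTangles G A → Disconnection A →
    ∃ λ B → B ≺ A × DistinguishesTwoTangles G B
  disconnection⇒distinguishing {A} d
      (B₁ , B₂ , (y₁ , y₁∈B₁) , (y₂ , y₂∈B₂) , disjoint , B₁∪B₂≡A , bd₁ , bd₂) =
    [ (λ d₁ → B₁ , ⊂⇒≺ B₁≤A B₁⊂A , d₁) , (λ d₂ → B₂ , ⊂⇒≺ B₂≤A B₂⊂A , d₂) ]′
      (distinguishing-part d B₁∪B₂≡A B₁≤A B₂≤A)
    where
    B₁≤A : lam G B₁ ≤ lam G A
    B₁≤A = p⊆q⇒∣p∣≤∣q∣ bd₁
    B₂≤A : lam G B₂ ≤ lam G A
    B₂≤A = p⊆q⇒∣p∣≤∣q∣ bd₂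
    B₁⊂A : B₁ ⊂ A
    B₁⊂A = ∪≡⇒⊆ˡ B₁∪B₂≡A , y₂ , ∪≡⇒⊆ʳ B₁∪B₂≡A y₂∈B₂ ,
           λ y₂∈B₁ → disjoint (y₂ , x∈p∩q⁺ (y₂∈B₁ , y₂∈B₂))
    B₂⊂A : B₂ ⊂ A
    B₂⊂A = ∪≡⇒⊆ʳ B₁∪B₂≡A , y₁ , ∪≡⇒⊆ˡ B₁∪B₂≡A y₁∈B₁ ,
           λ y₁∈B₂ → disjoint (y₁ , x∈p∩q⁺ (y₁∈B₁ , y₁∈B₂))

  Reduced : ESet G → Set
  Reduced A = ∣ Vof G A ∣ ≤ ∣ Vof G (co G A) ∣ × WellLinked G A × WellLinked G (co G A) ×
    InternallyConnected G A

  reduced⊎smaller : ∀ A → DistinguishesTwoTangles G A →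
    Reduced A ⊎ ∃ λ B → B ≺ A × DistinguishesTwoTangles G B
  reduced⊎smaller A d with ∣ Vof G A ∣ ≤? ∣ Vof G (co G A) ∣
  ... | no V≰V̄ = inj₂ (co G A , inj₂ (lam-co A , inj₁ (≰⇒> V≰V̄)) , distinguishes-co d)
  ... | yes V≤V̄ with wellLinked⊎lowerOrderSplit A
  ...   | inj₂ split = inj₂ (map₂ (map₁ inj₁) (lowerOrderSplit⇒distinguishing d split))
  ...   | inj₁ wlA with wellLinked⊎lowerOrderSplit (co G A)
  ...     | inj₂ split = inj₂ (map₂ (map₁ (inj₁ ∘′ subst (_ ℕ.<_) (lam-co A)))
                          (lowerOrderSplit⇒distinguishing (distinguishes-co d) split))
  ...     | inj₁ wlĀ with internallyConnected⊎disconnection A (distinguished-nonempty d)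
  ...       | inj₁ icA = inj₁ (V≤V̄ , wlA , wlĀ , icA)
  ...       | inj₂ disconnection = inj₂ (disconnection⇒distinguishing d disconnection)

lemma6p14 : (G : Hypergraph) (k : ℤ) →
    Σ (ESet G) (λ A → DistinguishesTwoTangles G A × (+ lam G A) < k) →
    Σ (ESet G) (λ A →
    DistinguishesTwoTangles G A ×
    (+ lam G A) < k ×
    ∣ Vof G A ∣ ≤ ∣ Vof G (co G A) ∣ ×
    WellLinked G A ×
    WellLinked G (co G A) ×
    InternallyConnected G A)
lemma6p14 G k (A , dA , A<k) =
  let B , (dB , B<k) , reducedB = wellFounded-descent (≺-wellFounded G) step A (dA , A<k)
  in  B , dB , B<k , reducedB
  where
  step : ∀ X → DistinguishesTwoTangles G X × (+ lam G X) < k →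
    Reduced G X ⊎ ∃ λ Y → _≺_ G Y X × DistinguishesTwoTangles G Y × (+ lam G Y) < k
  step X (dX , X<k) = Sum.map₂ (map₂ keep-order) (reduced⊎smaller G X dX)
    where
    keep-order : ∀ {Y} → _≺_ G Y X × DistinguishesTwoTangles G Y →
      _≺_ G Y X × DistinguishesTwoTangles G Y × (+ lam G Y) < k
    keep-order {Y} (Y≺X , dY) = Y≺X , dY , ℤ.≤-<-trans (ℤ.+≤+ (≺⇒lam≤ G {Y} {X} Y≺X)) X<k
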